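{- In any Eulerian orientation $\tau$ of $\Lambda_n$ (with free boundary conditions), a green cross and a red cross cannot coexist; that is, $C_{\mathrm{G}}\cap C_{\mathrm{R}}=\emptyset$.
   Context: $\Lambda_n$: internal vertices $(i,j)\in\mathbb{Z}^2$, $1\le i,j\le n$, nearest-neighbour edges between them, plus edges from each boundary internal vertex to its lattice neighbours outside the square (free boundary; external endpoints unconstrained). An Eulerian orientation is an orientation of all edges such that each internal vertex has two incoming and two outgoing edges. Let $\tau_{\mathrm{G}}$ be the orientation in which, at every internal vertex $(i,j)$ with $i+j$ even, both horizontal edges point into the vertex and both vertical edges point out, and at every internal vertex with $i+j$ odd, both horizontal edges point out and both vertical edges point in. In a state $\tau$, an edge is green if it is oriented as in $\tau_{\mathrm{G}}$ and red otherwise. A horizontal green (resp. red) bridge is a simple path consisting only of green (resp. red) edges from a horizontal edge on the left boundary of $\Lambda_n$ to a horizontal edge on the right boundary; vertical bridges are defined analogously from top to bottom. A state has a green (resp. red) cross if it has both a horizontal and a vertical green (resp. red) bridge. $C_{\mathrm{G}}$ (resp. $C_{\mathrm{R}}$) denotes the set of Eulerian orientations having a green (resp. red) cross. -}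

module Defs where

open import Data.Nat using (ℕ; zero; suc; _+_; _≤_)
open import Data.Bool using (Bool; true; false; not)
open import Data.Product using (_×_; _,_; Σ; ∃; ∃-syntax)
open import Data.List using (List; []; _∷_; _++_)
open import Data.List.Relation.Unary.Linked using (Linked)
open import Data.List.Relation.Unary.Unique.Propositional using (Unique)
open import Relation.Binary.PropositionalEquality using (_≡_; _≢_)

-- Lattice points; all relevant points have coordinates in 0..n+1,
-- so ℕ × ℕ suffices.  Internal vertices are (i , j) with 1 ≤ i , j ≤ n.
V : Set
V = ℕ × ℕ

-- Lattice edges, named by their "lower" endpoint:
--   hor i j  joins (i , j) and (suc i , j)
--   ver i j  joins (i , j) and (i , suc j)
data Edge : Set where
  hor : ℕ → ℕ → Edge
  ver : ℕ → ℕ → Edge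

-- Edges of Λ_n (free boundary): every lattice edge with at least one
-- internal endpoint.
IsEdge : ℕ → Edge → Set
IsEdge n (hor i j) = i ≤ n × 1 ≤ j × j ≤ n
IsEdge n (ver i j) = 1 ≤ i × i ≤ n × j ≤ n

data Joins : Edge → V → V → Set where
  hor⁺ : ∀ i j → Joins (hor i j) (i , j) (suc i , j)
  hor⁻ : ∀ i j → Joins (hor i j) (suc i , j) (i , j)
  ver⁺ : ∀ i j → Joins (ver i j) (i , j) (i , suc j)
  ver⁻ : ∀ i j → Joins (ver i j) (i , suc j) (i , j)

-- An orientation: τ (hor i j) = true  means  (i , j) → (i+1 , j);
--                 τ (ver i j) = true  means  (i , j) → (i , j+1).
-- (Values on non-edges of Λ_n are irrelevant.)
Orientation : Set
Orientation = Edge → Bool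

b2n : Bool → ℕ
b2n true  = 1
b2n false = 0

-- in-degree of an internal vertex (suc a , suc b)
indeg : Orientation → ℕ → ℕ → ℕ
indeg τ a b =
  b2n (τ (hor a (suc b))) + b2n (not (τ (hor (suc a) (suc b))))
  + b2n (τ (ver (suc a) b)) + b2n (not (τ (ver (suc a) (suc b))))

Eulerian : ℕ → Orientation → Set
Eulerian n τ = ∀ a b → suc a ≤ n → suc b ≤ n → indeg τ a b ≡ 2

odd : ℕ → Bool
odd zero    = false
odd (suc k) = not (odd k)

-- τ_G: at (i , j) with i+j even, horizontal edges point in, vertical out;
-- with i+j odd, the reverse.
τG : Orientation
τG (hor i j) = odd (i + j)
τG (ver i j) = not (odd (i + j))

Green : Orientation → Edge → Set
Green τ e = τ e ≡ τG e

Red : Orientation → Edge → Set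
Red τ e = τ e ≢ τG e

Step : ℕ → (Edge → Set) → V → V → Set
Step n C x y = ∃[ e ] (IsEdge n e × Joins e x y × C e)

SimplePath : ℕ → (Edge → Set) → List V → Set
SimplePath n C xs = Linked (Step n C) xs × Unique xs

HBridge : ℕ → (Edge → Set) → Set
HBridge n C = ∃[ xs ] (SimplePath n C xs
  × (∃[ j ] ∃[ ys ] (xs ≡ (0 , j) ∷ (1 , j) ∷ ys))
  × (∃[ j ] ∃[ zs ] (xs ≡ zs ++ (n , j) ∷ (suc n , j) ∷ [])))

VBridge : ℕ → (Edge → Set) → Set
VBridge n C = ∃[ xs ] (SimplePath n C xs
  × (∃[ i ] ∃[ ys ] (xs ≡ (i , 0) ∷ (i , 1) ∷ ys))
  × (∃[ i ] ∃[ zs ] (xs ≡ zs ++ (i , n) ∷ (i , suc n) ∷ [])))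

Cross : ℕ → (Edge → Set) → Set
Cross n C = HBridge n C × VBridge n C

HasGreenCross : ℕ → Orientation → Set
HasGreenCross n τ = Cross n (Green τ)

HasRedCross : ℕ → Orientation → Set
HasRedCross n τ = Cross n (Red τ)

-- The red vertical bridge Q separates Λ_n into a left and a right part: a face lies to the
-- right of Q when the horizontal segment from the far left to its centre meets an odd number
-- of vertical edges of Q.  Faces of column 0 lie to the left (Λ_n has no vertical edge on the
-- line x = 0), faces of column n to the right (Q joins the bottom to the top), and crossing
-- a green edge never changes sides, since Q is red.  Now follow a green horizontal bridge,
-- tracking the face above or to the right of its current edge.  Consecutive faces are
-- separated by green edges: when the bridge goes straight through a vertex, the Eulerian
-- condition (as many red horizontal as red vertical edges at every vertex) makes the
-- perpendicular edge between the two faces green as well.  So the first face, in column 0,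
-- and the last one, in column n, would lie on the same side of Q.
module Submission where

open import Defs
open import Algebra.Bundles using (CommutativeRing)
open import Data.Bool using (Bool; true; false; not; _∧_; _xor_)
open import Data.Bool.Properties
  using (xor-assoc; xor-comm; xor-same; xor-identityʳ; ∧-distribʳ-xor; ∧-zeroʳ;
         not-involutive; ¬-not; T-≡; xor-∧-commutativeRing)
open import Algebra.Properties.CommutativeSemigroup
  (CommutativeRing.+-commutativeSemigroup xor-∧-commutativeRing) using (interchange)
open import Data.List using (List; []; _∷_; _++_)
open import Data.List.Properties using (∷-injectiveʳ)
open import Data.List.Relation.Unary.Linked using (Linked; []; [-]; _∷_)
open import Data.Nat using (ℕ; suc; zero; _+_; _≤_; _⊓_; _<ᵇ_; _≤ᵇ_; _≡ᵇ_)
open import Data.Nat.Properties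
  using (+-suc; ≤⇒≤ᵇ; ≤ᵇ⇒≤; ≡ᵇ⇒≡; <⇒≱; <⇒≢; m≤n⇒m⊓n≡m; m≥n⇒m⊓n≡n; ⊓-idem; n≤1+n)
open import Data.Product using (_×_; _,_; proj₁; proj₂; uncurry)
open import Function using (_∘_)
open import Function.Bundles using (Equivalence)
open import Relation.Binary.PropositionalEquality
  using (_≡_; _≢_; refl; sym; trans; cong; cong₂; subst; module ≡-Reasoning)
open import Relation.Nullary using (¬_)

open ≡-Reasoning

module _ {a} {A : Set a} where

  lastPair : A → A → List A → A × A
  lastPair x y []       = x , y
  lastPair x y (z ∷ zs) = lastPair y z zs

  lastPair-++ : ∀ zs {x y : A} {ys} {a b : A} →
                x ∷ y ∷ ys ≡ zs ++ a ∷ b ∷ [] → lastPair x y ys ≡ (a , b)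
  lastPair-++ []                        refl = refl
  lastPair-++ (_ ∷ [])          {ys = []} ()
  lastPair-++ (_ ∷ _ ∷ [])      {ys = []} ()
  lastPair-++ (_ ∷ _ ∷ _ ∷ _)   {ys = []} ()
  lastPair-++ (_ ∷ zs)      {ys = _ ∷ _} eq = lastPair-++ zs (∷-injectiveʳ eq)

  module _ {r} {R : A → A → Set r} where

    Linked-lastPair : ∀ {x y ys} → Linked R (x ∷ y ∷ ys) → uncurry R (lastPair x y ys)
    Linked-lastPair (r ∷ [-])       = r
    Linked-lastPair (_ ∷ l@(_ ∷ _)) = Linked-lastPair l

    Linked-invariant : ∀ {b} {B : Set b} (ℓ : A → A → B) →
                       (∀ {x y z} → R x y → R y z → ℓ x y ≡ ℓ y z) →
                       ∀ {x y ys} → Linked R (x ∷ y ∷ ys) → ℓ x y ≡ uncurry ℓ (lastPair x y ys)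
    Linked-invariant ℓ step (_ ∷ [-])       = refl
    Linked-invariant ℓ step (r ∷ l@(s ∷ _)) = trans (step r s) (Linked-invariant ℓ step l)

xor-telescopes : ∀ a b c → (a xor b) xor (b xor c) ≡ a xor c
xor-telescopes a b c = begin
  (a xor b) xor (b xor c)  ≡⟨ xor-assoc a b (b xor c) ⟩
  a xor (b xor (b xor c))  ≡⟨ cong (a xor_) (sym (xor-assoc b b c)) ⟩
  a xor ((b xor b) xor c)  ≡⟨ cong (λ d → a xor (d xor c)) (xor-same b) ⟩
  a xor c                  ∎

xor≡false⇒≡ : ∀ {a b} → a xor b ≡ false → a ≡ b
xor≡false⇒≡ {false} {false} _ = refl
xor≡false⇒≡ {true}  {true}  _ = refl

<ᵇ-suc : ∀ m n → (m <ᵇ suc n) ≡ (m ≤ᵇ n)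
<ᵇ-suc zero    n = refl
<ᵇ-suc (suc m) n = refl

≤ᵇ-xor-<ᵇ : ∀ m n → (m ≤ᵇ n) xor (m <ᵇ n) ≡ (m ≡ᵇ n)
≤ᵇ-xor-<ᵇ zero    zero    = refl
≤ᵇ-xor-<ᵇ zero    (suc n) = refl
≤ᵇ-xor-<ᵇ (suc m) zero    = refl
≤ᵇ-xor-<ᵇ (suc m) (suc n) rewrite <ᵇ-suc m n = ≤ᵇ-xor-<ᵇ m n

≤ᵇ-xor-≤ᵇ-suc : ∀ m n → (m ≤ᵇ n) xor (m ≤ᵇ suc n) ≡ (m ≡ᵇ suc n)
≤ᵇ-xor-≤ᵇ-suc zero          n       = refl
≤ᵇ-xor-≤ᵇ-suc (suc zero)    zero    = refl
≤ᵇ-xor-≤ᵇ-suc (suc (suc m)) zero    = refl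
≤ᵇ-xor-≤ᵇ-suc (suc m)       (suc n) rewrite <ᵇ-suc m n | <ᵇ-suc m (suc n) = ≤ᵇ-xor-≤ᵇ-suc m n

≤⇒≤ᵇ≡true : ∀ {m n} → m ≤ n → (m ≤ᵇ n) ≡ true
≤⇒≤ᵇ≡true = Equivalence.to T-≡ ∘ ≤⇒≤ᵇ

≥⇒<ᵇ≡false : ∀ {m n} → n ≤ m → (m <ᵇ n) ≡ false
≥⇒<ᵇ≡false {m} {n} n≤m = ¬-not (λ m<n → <⇒≱ (≤ᵇ⇒≤ (suc m) n (Equivalence.from T-≡ m<n)) n≤m)

≢⇒≡ᵇ≡false : ∀ {m n} → m ≢ n → (m ≡ᵇ n) ≡ false
≢⇒≡ᵇ≡false {m} {n} m≢n = ¬-not (m≢n ∘ ≡ᵇ⇒≡ m n ∘ Equivalence.from T-≡)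

pair≢⇒≡ᵇ∧≡ᵇ≡false : ∀ a b c d → (a , b) ≢ (c , d) → ((a ≡ᵇ c) ∧ (b ≡ᵇ d)) ≡ false
pair≢⇒≡ᵇ∧≡ᵇ≡false a b c d ab≢cd with a ≡ᵇ c in a≡ᵇc
... | false = refl
... | true  = ≢⇒≡ᵇ≡false (ab≢cd ∘ cong₂ _,_ (≡ᵇ⇒≡ a c (Equivalence.from T-≡ a≡ᵇc)))

src tgt : Edge → V
src (hor i j) = i , j
src (ver i j) = i , j
tgt (hor i j) = suc i , j
tgt (ver i j) = i , suc j

Joins-xor : ∀ (g : V → Bool) {e u w} → Joins e u w → g (src e) xor g (tgt e) ≡ g u xor g w
Joins-xor g (hor⁺ i j) = refl
Joins-xor g (hor⁻ i j) = xor-comm (g (i , j)) (g (suc i , j))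
Joins-xor g (ver⁺ i j) = refl
Joins-xor g (ver⁻ i j) = xor-comm (g (i , j)) (g (i , suc j))

east-step⇒row≤n : ∀ {n C a b} → Step n C (a , b) (suc a , b) → b ≤ n
east-step⇒row≤n (_ , (_ , _ , b≤n) , hor⁺ _ _ , _) = b≤n

module _ {n : ℕ} {C : Edge → Set} where

  parity : ∀ {xs} → (Edge → Bool) → Linked (Step n C) xs → Bool
  parity f []      = false
  parity f [-]     = false
  parity f (s ∷ l) = f (proj₁ s) xor parity f l

  parity-xor : ∀ (f h : Edge → Bool) {xs} (l : Linked (Step n C) xs) →
               parity (λ e → f e xor h e) l ≡ parity f l xor parity h l
  parity-xor f h []      = refl
  parity-xor f h [-]     = refl
  parity-xor f h (s ∷ l) rewrite parity-xor f h l =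
    interchange (f (proj₁ s)) (h (proj₁ s)) (parity f l) (parity h l)

  parity-telescopes : ∀ (f : Edge → Bool) (g : V → Bool) →
                      (∀ e → IsEdge n e → C e → f e ≡ g (src e) xor g (tgt e)) →
                      ∀ {x y ys} (l : Linked (Step n C) (x ∷ y ∷ ys)) →
                      parity f l ≡ g x xor g (proj₂ (lastPair x y ys))
  parity-telescopes f g δg {x} {y} ((e , e∈ , x~y , c) ∷ [-]) =
    trans (xor-identityʳ (f e)) (trans (δg e e∈ c) (Joins-xor g x~y))
  parity-telescopes f g δg {x} {y} {z ∷ zs} ((e , e∈ , x~y , c) ∷ l) = begin
    f e xor parity f l                ≡⟨ cong₂ _xor_ (trans (δg e e∈ c) (Joins-xor g x~y))
                                                     (parity-telescopes f g δg l) ⟩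
    (g x xor g y) xor (g y xor g end) ≡⟨ xor-telescopes (g x) (g y) (g end) ⟩
    g x xor g end                     ∎
    where end = proj₂ (lastPair y z zs)

-- Faces are unit squares named by their lower left corner; face e is the face above a
-- horizontal edge e and to the right of a vertical one.
face : Edge → ℕ × ℕ
face (hor i j) = i , j
face (ver i j) = i , j

faceBetween : V → V → ℕ × ℕ
faceBetween (a , b) (c , d) = a ⊓ c , b ⊓ d

faceBetween-east : ∀ a b → faceBetween (a , b) (suc a , b) ≡ (a , b)
faceBetween-east a b = cong₂ _,_ (m≤n⇒m⊓n≡m (n≤1+n a)) (⊓-idem b)

faceBetween-north : ∀ a b → faceBetween (a , b) (a , suc b) ≡ (a , b)
faceBetween-north a b = cong₂ _,_ (⊓-idem a) (m≤n⇒m⊓n≡m (n≤1+n b))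

Joins⇒faceBetween≡face : ∀ {e u w} → Joins e u w → faceBetween u w ≡ face e
Joins⇒faceBetween≡face (hor⁺ i j) = faceBetween-east i j
Joins⇒faceBetween≡face (hor⁻ i j) = cong₂ _,_ (m≥n⇒m⊓n≡n (n≤1+n i)) (⊓-idem j)
Joins⇒faceBetween≡face (ver⁺ i j) = faceBetween-north i j
Joins⇒faceBetween≡face (ver⁻ i j) = cong₂ _,_ (⊓-idem i) (m≥n⇒m⊓n≡n (n≤1+n j))

data Incident : Edge → V → Set where
  east  : ∀ i j → Incident (hor i j) (i , j)
  west  : ∀ i j → Incident (hor i j) (suc i , j)
  north : ∀ i j → Incident (ver i j) (i , j)
  south : ∀ i j → Incident (ver i j) (i , suc j)

Joins⇒Incidentˡ : ∀ {e u w} → Joins e u w → Incident e u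
Joins⇒Incidentˡ (hor⁺ i j) = east i j
Joins⇒Incidentˡ (hor⁻ i j) = west i j
Joins⇒Incidentˡ (ver⁺ i j) = north i j
Joins⇒Incidentˡ (ver⁻ i j) = south i j

Joins⇒Incidentʳ : ∀ {e u w} → Joins e u w → Incident e w
Joins⇒Incidentʳ (hor⁺ i j) = west i j
Joins⇒Incidentʳ (hor⁻ i j) = east i j
Joins⇒Incidentʳ (ver⁺ i j) = south i j
Joins⇒Incidentʳ (ver⁻ i j) = north i j

-- At the internal vertex (suc a , suc b), with c = τG (hor a (suc b)), the four edges W, E, S, N
-- are green when τ takes the values c, not c, not c, c on them.
indeg≡2-W-E⇒N : ∀ {c W E S N} → W ≡ c → E ≡ not c →
                b2n W + b2n (not E) + b2n S + b2n (not N) ≡ 2 → N ≡ c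
indeg≡2-W-E⇒N {true}  {S = false} {true}  refl refl _ = refl
indeg≡2-W-E⇒N {true}  {S = false} {false} refl refl ()
indeg≡2-W-E⇒N {true}  {S = true}  {true}  refl refl ()
indeg≡2-W-E⇒N {true}  {S = true}  {false} refl refl ()
indeg≡2-W-E⇒N {false} {S = false} {true}  refl refl ()
indeg≡2-W-E⇒N {false} {S = false} {false} refl refl ()
indeg≡2-W-E⇒N {false} {S = true}  {true}  refl refl ()
indeg≡2-W-E⇒N {false} {S = true}  {false} refl refl _ = refl

indeg≡2-S-N⇒E : ∀ {c W E S N} → S ≡ not c → N ≡ c →
                b2n W + b2n (not E) + b2n S + b2n (not N) ≡ 2 → E ≡ not c
indeg≡2-S-N⇒E {true}  {true}  {true}  refl refl ()
indeg≡2-S-N⇒E {true}  {true}  {false} refl refl _ = refl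
indeg≡2-S-N⇒E {true}  {false} {true}  refl refl ()
indeg≡2-S-N⇒E {true}  {false} {false} refl refl ()
indeg≡2-S-N⇒E {false} {true}  {true}  refl refl ()
indeg≡2-S-N⇒E {false} {true}  {false} refl refl ()
indeg≡2-S-N⇒E {false} {false} {true}  refl refl _ = refl
indeg≡2-S-N⇒E {false} {false} {false} refl refl ()

module _ {n τ} (eul : Eulerian n τ) {a b} (a<n : suc a ≤ n) (b<n : suc b ≤ n) where

  green-W-E⇒green-N : Green τ (hor a (suc b)) → Green τ (hor (suc a) (suc b)) →
                      Green τ (ver (suc a) (suc b))
  green-W-E⇒green-N gW gE =
    trans (indeg≡2-W-E⇒N gW gE (eul a b a<n b<n)) (sym (not-involutive _))

  green-S-N⇒green-E : Green τ (ver (suc a) b) → Green τ (ver (suc a) (suc b)) →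
                      Green τ (hor (suc a) (suc b))
  green-S-N⇒green-E gS gN =
    indeg≡2-S-N⇒E (trans gS (cong not (sym odd-a+1+b))) (trans gN (not-involutive _))
                  (eul a b a<n b<n)
    where
    odd-a+1+b : odd (a + suc b) ≡ odd (suc a + b)
    odd-a+1+b = cong odd (+-suc a b)

module GreenPaths {n τ} (eul : Eulerian n τ) (Φ : ℕ → ℕ → Bool)
  (Φ-across-ver : ∀ x y → Green τ (ver (suc x) y) → Φ x y ≡ Φ (suc x) y)
  (Φ-across-hor : ∀ x y → suc y ≤ n → Green τ (hor x (suc y)) → Φ x y ≡ Φ x (suc y)) where

  faceValue : Edge → Bool
  faceValue = uncurry Φ ∘ face

  faceValue-W≡E : ∀ {i j} → IsEdge n (hor (suc i) j) → Green τ (hor i j) →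
                  Green τ (hor (suc i) j) → faceValue (hor i j) ≡ faceValue (hor (suc i) j)
  faceValue-W≡E {i} {suc b} (i<n , _ , b<n) gW gE =
    Φ-across-ver i (suc b) (green-W-E⇒green-N {τ = τ} eul i<n b<n gW gE)

  faceValue-W≡N : ∀ {i j} → Green τ (ver (suc i) j) →
                  faceValue (hor i j) ≡ faceValue (ver (suc i) j)
  faceValue-W≡N = Φ-across-ver _ _

  faceValue-W≡S : ∀ {i j} → IsEdge n (hor i (suc j)) → Green τ (hor i (suc j)) →
                  Green τ (ver (suc i) j) → faceValue (hor i (suc j)) ≡ faceValue (ver (suc i) j)
  faceValue-W≡S {i} {j} (_ , _ , j<n) gW gS =
    trans (sym (Φ-across-hor i j j<n gW)) (Φ-across-ver i j gS)

  faceValue-S≡E : ∀ {i j} → IsEdge n (hor i (suc j)) → Green τ (hor i (suc j)) →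
                  faceValue (ver i j) ≡ faceValue (hor i (suc j))
  faceValue-S≡E (_ , _ , j<n) = Φ-across-hor _ _ j<n

  faceValue-S≡N : ∀ {i j} → IsEdge n (ver i (suc j)) → Green τ (ver i j) →
                  Green τ (ver i (suc j)) → faceValue (ver i j) ≡ faceValue (ver i (suc j))
  faceValue-S≡N {suc a} {j} (_ , a<n , j<n) gS gN =
    Φ-across-hor (suc a) j j<n (green-S-N⇒green-E {τ = τ} eul a<n j<n gS gN)

  incident-green-faceValue : ∀ {e₁ e₂ v} → Incident e₁ v → Incident e₂ v →
                             IsEdge n e₁ → IsEdge n e₂ → Green τ e₁ → Green τ e₂ →
                             faceValue e₁ ≡ faceValue e₂
  incident-green-faceValue (east _ _)  (east _ _)  _  _  _  _  = refl
  incident-green-faceValue (east _ _)  (west _ _)  i₁ _  g₁ g₂ = sym (faceValue-W≡E i₁ g₂ g₁)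
  incident-green-faceValue (east _ _)  (north _ _) _  _  _  _  = refl
  incident-green-faceValue (east _ _)  (south _ _) i₁ _  g₁ _  = sym (faceValue-S≡E i₁ g₁)
  incident-green-faceValue (west _ _)  (east _ _)  _  i₂ g₁ g₂ = faceValue-W≡E i₂ g₁ g₂
  incident-green-faceValue (west _ _)  (west _ _)  _  _  _  _  = refl
  incident-green-faceValue (west _ _)  (north _ _) _  _  _  g₂ = faceValue-W≡N g₂
  incident-green-faceValue (west _ _)  (south _ _) i₁ _  g₁ g₂ = faceValue-W≡S i₁ g₁ g₂
  incident-green-faceValue (north _ _) (east _ _)  _  _  _  _  = refl
  incident-green-faceValue (north _ _) (west _ _)  _  _  g₁ _  = sym (faceValue-W≡N g₁)
  incident-green-faceValue (north _ _) (north _ _) _  _  _  _  = refl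
  incident-green-faceValue (north _ _) (south _ _) i₁ _  g₁ g₂ = sym (faceValue-S≡N i₁ g₂ g₁)
  incident-green-faceValue (south _ _) (east _ _)  _  i₂ _  g₂ = faceValue-S≡E i₂ g₂
  incident-green-faceValue (south _ _) (west _ _)  _  i₂ g₁ g₂ = sym (faceValue-W≡S i₂ g₂ g₁)
  incident-green-faceValue (south _ _) (north _ _) _  i₂ g₁ g₂ = faceValue-S≡N i₂ g₁ g₂
  incident-green-faceValue (south _ _) (south _ _) _  _  _  _  = refl

  stepValue : V → V → Bool
  stepValue u w = uncurry Φ (faceBetween u w)

  consecutive-green-steps : ∀ {x y z} → Step n (Green τ) x y → Step n (Green τ) y z →
                            stepValue x y ≡ stepValue y z
  consecutive-green-steps (e₁ , e₁∈ , x~y , g₁) (e₂ , e₂∈ , y~z , g₂) = begin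
    stepValue _ _  ≡⟨ cong (uncurry Φ) (Joins⇒faceBetween≡face x~y) ⟩
    faceValue e₁   ≡⟨ incident-green-faceValue (Joins⇒Incidentʳ x~y) (Joins⇒Incidentˡ y~z)
                                               e₁∈ e₂∈ g₁ g₂ ⟩
    faceValue e₂   ≡⟨ cong (uncurry Φ) (Joins⇒faceBetween≡face y~z) ⟨
    stepValue _ _  ∎

  green-path-stepValue : ∀ {x y ys} → Linked (Step n (Green τ)) (x ∷ y ∷ ys) →
                         stepValue x y ≡ uncurry stepValue (lastPair x y ys)
  green-path-stepValue = Linked-invariant stepValue consecutive-green-steps

module RightOfPath {n τ i₀ u₁ us} (Q : Linked (Step n (Red τ)) ((i₀ , 0) ∷ u₁ ∷ us))
  (Q-ends-on-top : proj₂ (proj₂ (lastPair (i₀ , 0) u₁ us)) ≡ suc n) where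

  end : V
  end = proj₂ (lastPair (i₀ , 0) u₁ us)

  -- ver a y meets the horizontal segment from the far left to the centre of the face (x , y)
  crossesLeftOf : ℕ → ℕ → Edge → Bool
  crossesLeftOf x y (hor _ _) = false
  crossesLeftOf x y (ver a b) = (a ≤ᵇ x) ∧ (b ≡ᵇ y)

  rightOf : ℕ → ℕ → Bool
  rightOf x y = parity (crossesLeftOf x y) Q

  rightOf-column₀ : ∀ y → rightOf 0 y ≡ false
  rightOf-column₀ y = parity-telescopes (crossesLeftOf 0 y) (λ _ → false) noCrossing Q
    where
    noCrossing : ∀ e → IsEdge n e → Red τ e → crossesLeftOf 0 y e ≡ false
    noCrossing (hor _ _)       _ _ = refl
    noCrossing (ver (suc _) _) _ _ = refl

  rightOf-columnₙ : ∀ y → y ≤ n → rightOf n y ≡ true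
  rightOf-columnₙ y y≤n = begin
    rightOf n y            ≡⟨ parity-telescopes (crossesLeftOf n y) below δbelow Q ⟩
    true xor below end     ≡⟨ cong (λ h → true xor (h ≤ᵇ y)) Q-ends-on-top ⟩
    true xor (suc n ≤ᵇ y)  ≡⟨ cong (true xor_) (≥⇒<ᵇ≡false y≤n) ⟩
    true                   ∎
    where
    below : V → Bool
    below v = proj₂ v ≤ᵇ y
    δbelow : ∀ e → IsEdge n e → Red τ e → crossesLeftOf n y e ≡ below (src e) xor below (tgt e)
    δbelow (hor _ j) _ _ = sym (xor-same (j ≤ᵇ y))
    δbelow (ver i j) (_ , i≤n , _) _ rewrite ≤⇒≤ᵇ≡true i≤n = sym (≤ᵇ-xor-<ᵇ j y)

  rightOf-across-ver : ∀ x y → Green τ (ver (suc x) y) → rightOf x y ≡ rightOf (suc x) y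
  rightOf-across-ver x y green = xor≡false⇒≡ (begin
    rightOf x y xor rightOf (suc x) y  ≡⟨ parity-xor _ _ Q ⟨
    parity (λ e → crossesLeftOf x y e xor crossesLeftOf (suc x) y e) Q
                                       ≡⟨ parity-telescopes _ (λ _ → false) onlyAtGreen Q ⟩
    false                              ∎)
    where
    onlyAtGreen : ∀ e → IsEdge n e → Red τ e →
                  crossesLeftOf x y e xor crossesLeftOf (suc x) y e ≡ false
    onlyAtGreen (hor _ _) _ _   = refl
    onlyAtGreen (ver a b) _ red = begin
      ((a ≤ᵇ x) ∧ (b ≡ᵇ y)) xor ((a ≤ᵇ suc x) ∧ (b ≡ᵇ y)) ≡⟨ ∧-distribʳ-xor _ (a ≤ᵇ x) _ ⟨
      ((a ≤ᵇ x) xor (a ≤ᵇ suc x)) ∧ (b ≡ᵇ y)            ≡⟨ cong (_∧ (b ≡ᵇ y)) (≤ᵇ-xor-≤ᵇ-suc a x) ⟩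
      (a ≡ᵇ suc x) ∧ (b ≡ᵇ y)                           ≡⟨ pair≢⇒≡ᵇ∧≡ᵇ≡false a b (suc x) y
                                                              (λ { refl → red green }) ⟩
      false                                             ∎

  rightOf-across-hor : ∀ x y → suc y ≤ n → Green τ (hor x (suc y)) →
                       rightOf x y ≡ rightOf x (suc y)
  rightOf-across-hor x y y<n green = xor≡false⇒≡ (begin
    rightOf x y xor rightOf x (suc y)  ≡⟨ parity-xor _ _ Q ⟨
    parity (λ e → crossesLeftOf x y e xor crossesLeftOf x (suc y) e) Q
                                       ≡⟨ parity-telescopes _ onRow δonRow Q ⟩
    onRow (i₀ , 0) xor onRow end       ≡⟨ cong₂ _xor_ (∧-zeroʳ (i₀ ≤ᵇ x)) endOffRow ⟩
    false                              ∎)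
    where
    onRow : V → Bool
    onRow v = (proj₁ v ≤ᵇ x) ∧ (proj₂ v ≡ᵇ suc y)
    δonRow : ∀ e → IsEdge n e → Red τ e →
             crossesLeftOf x y e xor crossesLeftOf x (suc y) e ≡ onRow (src e) xor onRow (tgt e)
    δonRow (hor i j) _ red = sym (begin
      ((i ≤ᵇ x) ∧ (j ≡ᵇ suc y)) xor ((i <ᵇ x) ∧ (j ≡ᵇ suc y))
        ≡⟨ ∧-distribʳ-xor _ (i ≤ᵇ x) _ ⟨
      ((i ≤ᵇ x) xor (i <ᵇ x)) ∧ (j ≡ᵇ suc y)
        ≡⟨ cong (_∧ (j ≡ᵇ suc y)) (≤ᵇ-xor-<ᵇ i x) ⟩
      (i ≡ᵇ x) ∧ (j ≡ᵇ suc y)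
        ≡⟨ pair≢⇒≡ᵇ∧≡ᵇ≡false i j x (suc y) (λ { refl → red green }) ⟩
      false
        ∎)
    δonRow (ver i j) _ _ = xor-comm ((i ≤ᵇ x) ∧ (j ≡ᵇ y)) ((i ≤ᵇ x) ∧ (j ≡ᵇ suc y))
    endOffRow : onRow end ≡ false
    endOffRow = begin
      (proj₁ end ≤ᵇ x) ∧ (proj₂ end ≡ᵇ suc y)
        ≡⟨ cong (λ h → (proj₁ end ≤ᵇ x) ∧ (h ≡ᵇ suc y)) Q-ends-on-top ⟩
      (proj₁ end ≤ᵇ x) ∧ (n ≡ᵇ y)
        ≡⟨ cong ((proj₁ end ≤ᵇ x) ∧_) (≢⇒≡ᵇ≡false (<⇒≢ y<n ∘ sym)) ⟩
      (proj₁ end ≤ᵇ x) ∧ false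
        ≡⟨ ∧-zeroʳ _ ⟩
      false
        ∎

greenHBridge⇒¬redVBridge : ∀ {n τ} → Eulerian n τ → HBridge n (Green τ) → ¬ VBridge n (Red τ)
greenHBridge⇒¬redVBridge {n} {τ} eul (_ , (P , _) , (j₀ , ys , refl) , (j₁ , zs , P-ends))
                                     (_ , (Q , _) , (i₀ , qs , refl) , (i₁ , qzs , Q-ends))
  = false≢true (begin
    false                                ≡⟨ rightOf-column₀ j₀ ⟨
    rightOf 0 j₀                         ≡⟨ cong (uncurry rightOf) (faceBetween-east 0 j₀) ⟨
    stepValue (0 , j₀) (1 , j₀)          ≡⟨ green-path-stepValue P ⟩
    uncurry stepValue (lastPair _ _ ys)  ≡⟨ cong (uncurry stepValue) P-last ⟩
    stepValue (n , j₁) (suc n , j₁)      ≡⟨ cong (uncurry rightOf) (faceBetween-east n j₁) ⟩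
    rightOf n j₁                         ≡⟨ rightOf-columnₙ j₁ (east-step⇒row≤n lastStep) ⟩
    true                                 ∎)
  where
  open RightOfPath Q (cong (proj₂ ∘ proj₂) (lastPair-++ qzs Q-ends))
  open GreenPaths {τ = τ} eul rightOf rightOf-across-ver rightOf-across-hor
  P-last : lastPair (0 , j₀) (1 , j₀) ys ≡ ((n , j₁) , (suc n , j₁))
  P-last = lastPair-++ zs P-ends
  lastStep : Step n (Green τ) (n , j₁) (suc n , j₁)
  lastStep = subst (uncurry (Step n (Green τ))) P-last (Linked-lastPair P)
  false≢true : false ≢ true
  false≢true ()

mainTheorem2 : (n : ℕ) (τ : Orientation) → Eulerian n τ → ¬ (HasGreenCross n τ × HasRedCross n τ)
mainTheorem2 n τ eul ((greenH , _) , (_ , redV)) = greenHBridge⇒¬redVBridge eul greenH redV
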